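{- Let $p, n \in \mathbb{N}$ and $k \in \mathbb{N}_0$ with $0 \le k \le p$. Then $$\overline{H}_{n}^{(p)}=\sum_{j=1}^{k}(-1)^{j}\sum_{\ell=1}^{n}\frac{(-1)^{n+1-\ell}(n+1)}{\ell^{j}(n+1-\ell)^{p+1-j}}+(-1)^{k+1}\sum_{\ell=1}^{n}\frac{(-1)^{n+1-\ell}}{\ell^{k}(n+1-\ell)^{p-k}}.$$ In particular, if $p+n$ is even then $$\overline{H}_{n}^{(p)}=\frac{n+1}{2}\sum_{j=1}^{p}(-1)^{j}\sum_{\ell=1}^{n}\frac{(-1)^{n+1-\ell}}{\ell^{j}(n+1-\ell)^{p+1-j}},$$ and if $p+n$ is odd then $$\sum_{j=1}^{p}(-1)^{j}\sum_{\ell=1}^{n}\frac{(-1)^{n+1-\ell}}{\ell^{j}(n+1-\ell)^{p+1-j}}=0.$$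
   Context: For $n,p\in\mathbb{N}$, $\overline{H}_n^{(p)}=\sum_{j=1}^n (-1)^{j-1}/j^p$ is the generalized alternating harmonic number. Empty sums are $0$. -}

module Defs where

open import Data.Nat as ℕ using (ℕ; zero; suc)
open import Data.Integer using (+_)
open import Data.Rational using (ℚ; 0ℚ; 1ℚ; _+_; _*_; -_; _/_)

sgn : ℕ → ℚ
sgn zero = 1ℚ
sgn (suc m) = - sgn m

-- 1/m for m ≥ 1 (value at 0 is irrelevant: only used with positive arguments)
inv : ℕ → ℚ
inv zero = 0ℚ
inv (suc m) = (+ 1) / suc m

sum1 : ℕ → (ℕ → ℚ) → ℚ
sum1 zero f = 0ℚ
sum1 (suc n) f = sum1 n f + f (suc n)

Hbar : ℕ → ℕ → ℚ
Hbar n p = sum1 n (λ j → sgn (j ℕ.∸ 1) * inv (j ℕ.^ p))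

term : ℕ → ℕ → ℕ → ℕ → ℚ
term n a b ℓ = sgn (suc n ℕ.∸ ℓ) * inv ((ℓ ℕ.^ a) ℕ.* ((suc n ℕ.∸ ℓ) ℕ.^ b))

ℕ→ℚ : ℕ → ℚ
ℕ→ℚ m = (+ m) / 1

-- Since (n+1) = ℓ + (n+1-ℓ), every summand splits by partial fractions:
--   (n+1) / (ℓ^j (n+1-ℓ)^(p+1-j)) = 1/(ℓ^(j-1) (n+1-ℓ)^(p+1-j)) + 1/(ℓ^j (n+1-ℓ)^(p-j)).
-- Hence the k-th right-hand side does not depend on k; at k = 0 it is H̄ summed in reverse
-- order. At k = p the remainder is (-1)^(p+1) (-1)^n H̄, so H̄ (1 + (-1)^(p+n)) equals
-- (n+1) times the double sum, which gives both parity statements.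
module Submission where

open import Defs
open import Data.Nat as ℕ using (ℕ; zero; suc; _≤_; _∸_)
open import Data.Nat.DivMod using (_%_; _/_; m≡m%n+[m/n]*n)
import Data.Nat.Properties as ℕ
open import Data.Integer as ℤ using (+_)
import Data.Integer.Properties as ℤ
open import Data.Integer.Solver using (module +-*-Solver)
open import Data.Rational using (ℚ; 0ℚ; 1ℚ; _+_; _*_; -_; toℚᵘ)
  renaming (_/_ to _/ℚ_)
open import Data.Rational.Properties
  using (toℚᵘ-injective; toℚᵘ-fromℚᵘ; toℚᵘ-homo-+; toℚᵘ-homo-*;
         *-identityˡ; *-identityʳ; *-zeroˡ; *-zeroʳ; *-assoc; +-identityˡ; +-identityʳ;
         +-assoc; +-comm; *-distribˡ-+; *-distribʳ-+)
open import Data.Rational.Solver renaming (module +-*-Solver to ℚ-Solver)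
open import Data.Rational.Unnormalised using (mkℚᵘ; *≡*; _≃_)
import Data.Rational.Unnormalised.Properties as ℚᵘ
open import Data.Product using (_×_; _,_)
open import Relation.Binary.PropositionalEquality
open ≡-Reasoning

toℚᵘ-/suc : ∀ i d → toℚᵘ (i /ℚ suc d) ≃ mkℚᵘ i d
toℚᵘ-/suc i d = toℚᵘ-fromℚᵘ (mkℚᵘ i d)

ℕ→ℚ-+ : ∀ a b → ℕ→ℚ (a ℕ.+ b) ≡ ℕ→ℚ a + ℕ→ℚ b
ℕ→ℚ-+ a b = toℚᵘ-injective (ℚᵘ.≃-trans (toℚᵘ-/suc (+ (a ℕ.+ b)) 0) (ℚᵘ.≃-trans (*≡* eq)
  (ℚᵘ.≃-sym (ℚᵘ.≃-trans (toℚᵘ-homo-+ (ℕ→ℚ a) (ℕ→ℚ b))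
                        (ℚᵘ.+-cong (toℚᵘ-/suc (+ a) 0) (toℚᵘ-/suc (+ b) 0))))))
  where
  open +-*-Solver
  eq : + (a ℕ.+ b) ℤ.* (+ 1 ℤ.* + 1) ≡ (+ a ℤ.* + 1 ℤ.+ + b ℤ.* + 1) ℤ.* + 1
  eq rewrite ℤ.pos-+ a b =
    solve 2 (λ x y → (x :+ y) :* (con (+ 1) :* con (+ 1)) := (x :* con (+ 1) :+ y :* con (+ 1)) :* con (+ 1))
      refl (+ a) (+ b)

ℕ→ℚ-* : ∀ a b → ℕ→ℚ (a ℕ.* b) ≡ ℕ→ℚ a * ℕ→ℚ b
ℕ→ℚ-* a b = toℚᵘ-injective (ℚᵘ.≃-trans (toℚᵘ-/suc (+ (a ℕ.* b)) 0) (ℚᵘ.≃-trans (*≡* eq)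
  (ℚᵘ.≃-sym (ℚᵘ.≃-trans (toℚᵘ-homo-* (ℕ→ℚ a) (ℕ→ℚ b))
                        (ℚᵘ.*-cong (toℚᵘ-/suc (+ a) 0) (toℚᵘ-/suc (+ b) 0))))))
  where
  open +-*-Solver
  eq : + (a ℕ.* b) ℤ.* (+ 1 ℤ.* + 1) ≡ (+ a ℤ.* + b) ℤ.* + 1
  eq = trans (solve 1 (λ x → x :* (con (+ 1) :* con (+ 1)) := x :* con (+ 1)) refl (+ (a ℕ.* b)))
             (cong (ℤ._* + 1) (ℤ.pos-* a b))

ℕ→ℚ-*-inv : ∀ m → ℕ→ℚ (suc m) * inv (suc m) ≡ 1ℚ
ℕ→ℚ-*-inv m = toℚᵘ-injective (ℚᵘ.≃-trans (toℚᵘ-homo-* (ℕ→ℚ (suc m)) (inv (suc m)))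
  (ℚᵘ.≃-trans (ℚᵘ.*-cong (toℚᵘ-/suc (+ suc m) 0) (toℚᵘ-/suc (+ 1) m)) (*≡* eq)))
  where
  open +-*-Solver
  eq : (+ suc m ℤ.* + 1) ℤ.* + 1 ≡ + 1 ℤ.* (+ 1 ℤ.* + suc m)
  eq = solve 1 (λ x → (x :* con (+ 1)) :* con (+ 1) := con (+ 1) :* (con (+ 1) :* x)) refl (+ suc m)

half-+-half : ∀ m → (+ m) /ℚ 2 + (+ m) /ℚ 2 ≡ ℕ→ℚ m
half-+-half m = toℚᵘ-injective (ℚᵘ.≃-trans (toℚᵘ-homo-+ ((+ m) /ℚ 2) ((+ m) /ℚ 2))
  (ℚᵘ.≃-trans (ℚᵘ.+-cong (toℚᵘ-/suc (+ m) 1) (toℚᵘ-/suc (+ m) 1))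
  (ℚᵘ.≃-trans (*≡* eq) (ℚᵘ.≃-sym (toℚᵘ-/suc (+ m) 0)))))
  where
  open +-*-Solver
  eq : (+ m ℤ.* + 2 ℤ.+ + m ℤ.* + 2) ℤ.* + 1 ≡ + m ℤ.* (+ 2 ℤ.* + 2)
  eq = solve 1 (λ x → (x :* con (+ 2) :+ x :* con (+ 2)) :* con (+ 1) := x :* (con (+ 2) :* con (+ 2)))
    refl (+ m)

-- inv 0 = 0 makes this hold without side conditions.
inv-* : ∀ a b → inv (a ℕ.* b) ≡ inv a * inv b
inv-* zero b = sym (*-zeroˡ (inv b))
inv-* (suc a) zero rewrite ℕ.*-zeroʳ a = sym (*-zeroʳ (inv (suc a)))
inv-* (suc a) (suc b) = begin
  I                             ≡⟨ sym (*-identityʳ I) ⟩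
  I * 1ℚ                        ≡⟨ cong (I *_) (sym (cong₂ _*_ (ℕ→ℚ-*-inv a) (ℕ→ℚ-*-inv b))) ⟩
  I * ((A * i) * (B * j))       ≡⟨ solve 5 (λ I A i B j → I :* ((A :* i) :* (B :* j)) := ((A :* B) :* I) :* (i :* j))
                                     refl I A i B j ⟩
  ((A * B) * I) * (i * j)       ≡⟨ cong (λ z → (z * I) * (i * j)) (sym (ℕ→ℚ-* (suc a) (suc b))) ⟩
  (ℕ→ℚ (suc a ℕ.* suc b) * I) * (i * j) ≡⟨ cong (_* (i * j)) (ℕ→ℚ-*-inv (b ℕ.+ a ℕ.* suc b)) ⟩
  1ℚ * (i * j)                  ≡⟨ *-identityˡ (i * j) ⟩
  i * j                         ∎
  where
  open ℚ-Solver
  I = inv (suc a ℕ.* suc b)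
  A = ℕ→ℚ (suc a)
  B = ℕ→ℚ (suc b)
  i = inv (suc a)
  j = inv (suc b)

sum1-cong : ∀ n {f g : ℕ → ℚ} → (∀ ℓ → 1 ≤ ℓ → ℓ ≤ n → f ℓ ≡ g ℓ) → sum1 n f ≡ sum1 n g
sum1-cong zero     f≗g = refl
sum1-cong (suc n) f≗g =
  cong₂ _+_ (sum1-cong n (λ ℓ 1≤ℓ ℓ≤n → f≗g ℓ 1≤ℓ (ℕ.m≤n⇒m≤1+n ℓ≤n))) (f≗g (suc n) (ℕ.s≤s ℕ.z≤n) ℕ.≤-refl)

sum1-+ : ∀ n (f g : ℕ → ℚ) → sum1 n (λ ℓ → f ℓ + g ℓ) ≡ sum1 n f + sum1 n g
sum1-+ zero    f g = refl
sum1-+ (suc n) f g = begin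
  sum1 n (λ ℓ → f ℓ + g ℓ) + (f (suc n) + g (suc n)) ≡⟨ cong (_+ (f (suc n) + g (suc n))) (sum1-+ n f g) ⟩
  (sum1 n f + sum1 n g) + (f (suc n) + g (suc n))    ≡⟨ solve 4 (λ a b c d → (a :+ b) :+ (c :+ d) := (a :+ c) :+ (b :+ d))
                                                          refl (sum1 n f) (sum1 n g) (f (suc n)) (g (suc n)) ⟩
  (sum1 n f + f (suc n)) + (sum1 n g + g (suc n))    ∎
  where open ℚ-Solver

sum1-*ˡ : ∀ n c (f : ℕ → ℚ) → sum1 n (λ ℓ → c * f ℓ) ≡ c * sum1 n f
sum1-*ˡ zero    c f = sym (*-zeroʳ c)
sum1-*ˡ (suc n) c f = begin
  sum1 n (λ ℓ → c * f ℓ) + c * f (suc n) ≡⟨ cong (_+ c * f (suc n)) (sum1-*ˡ n c f) ⟩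
  c * sum1 n f + c * f (suc n)           ≡⟨ solve 3 (λ c a b → c :* a :+ c :* b := c :* (a :+ b)) refl c (sum1 n f) (f (suc n)) ⟩
  c * (sum1 n f + f (suc n))             ∎
  where open ℚ-Solver

sum1-suc : ∀ n (f : ℕ → ℚ) → sum1 (suc n) f ≡ f 1 + sum1 n (λ ℓ → f (suc ℓ))
sum1-suc zero    f = trans (+-identityˡ (f 1)) (sym (+-identityʳ (f 1)))
sum1-suc (suc n) f = begin
  sum1 (suc n) f + f (suc (suc n))                     ≡⟨ cong (_+ f (suc (suc n))) (sum1-suc n f) ⟩
  (f 1 + sum1 n (λ ℓ → f (suc ℓ))) + f (suc (suc n))  ≡⟨ +-assoc (f 1) _ _ ⟩
  f 1 + (sum1 n (λ ℓ → f (suc ℓ)) + f (suc (suc n)))  ∎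

sum1-reverse : ∀ n (f : ℕ → ℚ) → sum1 n (λ ℓ → f (suc n ∸ ℓ)) ≡ sum1 n f
sum1-reverse zero    f = refl
sum1-reverse (suc n) f = begin
  sum1 (suc n) (λ ℓ → f (suc (suc n) ∸ ℓ)) ≡⟨ sum1-suc n (λ ℓ → f (suc (suc n) ∸ ℓ)) ⟩
  f (suc n) + sum1 n (λ ℓ → f (suc n ∸ ℓ))  ≡⟨ cong (λ s → f (suc n) + s) (sum1-reverse n f) ⟩
  f (suc n) + sum1 n f                      ≡⟨ +-comm (f (suc n)) (sum1 n f) ⟩
  sum1 n f + f (suc n)                      ∎

sgn-+ : ∀ a b → sgn (a ℕ.+ b) ≡ sgn a * sgn b
sgn-+ zero    b = sym (*-identityˡ (sgn b))
sgn-+ (suc a) b = begin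
  - sgn (a ℕ.+ b)   ≡⟨ cong -_ (sgn-+ a b) ⟩
  - (sgn a * sgn b) ≡⟨ solve 2 (λ x y → :- (x :* y) := (:- x) :* y) refl (sgn a) (sgn b) ⟩
  (- sgn a) * sgn b ∎
  where open ℚ-Solver

sgn-*-sgn : ∀ a → sgn a * sgn a ≡ 1ℚ
sgn-*-sgn zero    = refl
sgn-*-sgn (suc a) = trans (solve 1 (λ x → (:- x) :* (:- x) := x :* x) refl (sgn a)) (sgn-*-sgn a)
  where open ℚ-Solver

sgn-∸ : ∀ n l → l ≤ n → sgn (n ∸ l) ≡ sgn n * sgn l
sgn-∸ n l l≤n = begin
  sgn (n ∸ l)                   ≡⟨ sym (*-identityʳ _) ⟩
  sgn (n ∸ l) * 1ℚ              ≡⟨ cong (sgn (n ∸ l) *_) (sym (sgn-*-sgn l)) ⟩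
  sgn (n ∸ l) * (sgn l * sgn l) ≡⟨ sym (*-assoc (sgn (n ∸ l)) (sgn l) (sgn l)) ⟩
  (sgn (n ∸ l) * sgn l) * sgn l ≡⟨ cong (_* sgn l) (sym (sgn-+ (n ∸ l) l)) ⟩
  sgn (n ∸ l ℕ.+ l) * sgn l     ≡⟨ cong (λ m → sgn m * sgn l) (ℕ.m∸n+n≡m l≤n) ⟩
  sgn n * sgn l                 ∎

sgn-*2 : ∀ q → sgn (q ℕ.* 2) ≡ 1ℚ
sgn-*2 zero    = refl
sgn-*2 (suc q) = trans (solve 1 (λ x → :- (:- x) := x) refl (sgn (q ℕ.* 2))) (sgn-*2 q)
  where open ℚ-Solver

sgn-%2 : ∀ m → sgn m ≡ sgn (m % 2)
sgn-%2 m = begin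
  sgn m                                   ≡⟨ cong sgn (m≡m%n+[m/n]*n m 2) ⟩
  sgn (m % 2 ℕ.+ (m / 2) ℕ.* 2)           ≡⟨ sgn-+ (m % 2) ((m / 2) ℕ.* 2) ⟩
  sgn (m % 2) * sgn ((m / 2) ℕ.* 2)       ≡⟨ cong (sgn (m % 2) *_) (sgn-*2 (m / 2)) ⟩
  sgn (m % 2) * 1ℚ                        ≡⟨ *-identityʳ _ ⟩
  sgn (m % 2)                             ∎

partialFraction : ∀ l m a b →
  ℕ→ℚ (suc l ℕ.+ suc m) * inv ((suc l ℕ.^ suc a) ℕ.* (suc m ℕ.^ suc b))
  ≡ inv ((suc l ℕ.^ a) ℕ.* (suc m ℕ.^ suc b)) + inv ((suc l ℕ.^ suc a) ℕ.* (suc m ℕ.^ b))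
partialFraction l m a b = begin
  ℕ→ℚ (L ℕ.+ M) * inv ((L ℕ.* La) ℕ.* (M ℕ.* Mb))
    ≡⟨ cong₂ _*_ (ℕ→ℚ-+ L M) (trans (inv-* (L ℕ.* La) (M ℕ.* Mb)) (cong₂ _*_ (inv-* L La) (inv-* M Mb))) ⟩
  (NL + NM) * ((iL * x) * (iM * y))
    ≡⟨ solve 6 (λ NL NM iL x iM y → (NL :+ NM) :* ((iL :* x) :* (iM :* y))
                                  := (NL :* iL) :* (x :* (iM :* y)) :+ (NM :* iM) :* ((iL :* x) :* y))
         refl NL NM iL x iM y ⟩
  (NL * iL) * (x * (iM * y)) + (NM * iM) * ((iL * x) * y)
    ≡⟨ cong₂ (λ u v → u * (x * (iM * y)) + v * ((iL * x) * y)) (ℕ→ℚ-*-inv l) (ℕ→ℚ-*-inv m) ⟩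
  1ℚ * (x * (iM * y)) + 1ℚ * ((iL * x) * y)
    ≡⟨ cong₂ _+_ (*-identityˡ (x * (iM * y))) (*-identityˡ ((iL * x) * y)) ⟩
  x * (iM * y) + (iL * x) * y
    ≡⟨ sym (cong₂ _+_ (trans (inv-* La (M ℕ.* Mb)) (cong (x *_) (inv-* M Mb)))
                      (trans (inv-* (L ℕ.* La) Mb) (cong (_* y) (inv-* L La)))) ⟩
  inv (La ℕ.* (M ℕ.* Mb)) + inv ((L ℕ.* La) ℕ.* Mb) ∎
  where
  open ℚ-Solver
  L  = suc l
  M  = suc m
  La = L ℕ.^ a
  Mb = M ℕ.^ b
  NL = ℕ→ℚ L
  NM = ℕ→ℚ M
  iL = inv L
  iM = inv M
  x  = inv La
  y  = inv Mb

term-partialFraction : ∀ n a b ℓ → 1 ≤ ℓ → ℓ ≤ n →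
  ℕ→ℚ (suc n) * term n (suc a) (suc b) ℓ ≡ term n a (suc b) ℓ + term n (suc a) b ℓ
term-partialFraction n a b (suc l) _ l<n
  with suc n ∸ suc l | ℕ.m+[n∸m]≡n (ℕ.m≤n⇒m≤1+n l<n) | ℕ.+-∸-assoc 1 l<n
... | .(suc (n ∸ suc l)) | l+m≡n | refl = begin
  ℕ→ℚ (suc n) * (s * inv ((suc l ℕ.^ suc a) ℕ.* (suc m ℕ.^ suc b)))
    ≡⟨ cong (λ k → ℕ→ℚ k * (s * inv ((suc l ℕ.^ suc a) ℕ.* (suc m ℕ.^ suc b)))) (sym l+m≡n) ⟩
  ℕ→ℚ (suc l ℕ.+ suc m) * (s * inv ((suc l ℕ.^ suc a) ℕ.* (suc m ℕ.^ suc b)))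
    ≡⟨ solve 3 (λ N s i → N :* (s :* i) := s :* (N :* i)) refl (ℕ→ℚ (suc l ℕ.+ suc m)) s _ ⟩
  s * (ℕ→ℚ (suc l ℕ.+ suc m) * inv ((suc l ℕ.^ suc a) ℕ.* (suc m ℕ.^ suc b)))
    ≡⟨ cong (s *_) (partialFraction l m a b) ⟩
  s * (inv ((suc l ℕ.^ a) ℕ.* (suc m ℕ.^ suc b)) + inv ((suc l ℕ.^ suc a) ℕ.* (suc m ℕ.^ b)))
    ≡⟨ *-distribˡ-+ s _ _ ⟩
  s * inv ((suc l ℕ.^ a) ℕ.* (suc m ℕ.^ suc b)) + s * inv ((suc l ℕ.^ suc a) ℕ.* (suc m ℕ.^ b)) ∎
  where
  open ℚ-Solver
  m = n ∸ suc l
  s = sgn (suc m)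

ℕ→ℚ-suc-*-zero : ∀ m x → ℕ→ℚ (suc m) * x ≡ 0ℚ → x ≡ 0ℚ
ℕ→ℚ-suc-*-zero m x Nx≡0 = begin
  x                         ≡⟨ sym (*-identityˡ x) ⟩
  1ℚ * x                    ≡⟨ cong (_* x) (sym (ℕ→ℚ-*-inv m)) ⟩
  (N * inv (suc m)) * x     ≡⟨ solve 3 (λ N i x → (N :* i) :* x := i :* (N :* x)) refl N (inv (suc m)) x ⟩
  inv (suc m) * (N * x)     ≡⟨ cong (inv (suc m) *_) Nx≡0 ⟩
  inv (suc m) * 0ℚ          ≡⟨ *-zeroʳ (inv (suc m)) ⟩
  0ℚ                        ∎
  where
  open ℚ-Solver
  N = ℕ→ℚ (suc m)

x+x≡y+y⇒x≡y : ∀ x y → x + x ≡ y + y → x ≡ y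
x+x≡y+y⇒x≡y x y 2x≡2y = begin
  x            ≡⟨ sym (*-identityˡ x) ⟩
  (½ + ½) * x  ≡⟨ solve 2 (λ h x → (h :+ h) :* x := h :* (x :+ x)) refl ½ x ⟩
  ½ * (x + x)  ≡⟨ cong (½ *_) 2x≡2y ⟩
  ½ * (y + y)  ≡⟨ solve 2 (λ h y → h :* (y :+ y) := (h :+ h) :* y) refl ½ y ⟩
  (½ + ½) * y  ≡⟨ *-identityˡ y ⟩
  y            ∎
  where
  open ℚ-Solver
  ½ = (+ 1) /ℚ 2

termSum : ℕ → ℕ → ℕ → ℚ
termSum n a b = sum1 n (term n a b)

doubleSum : ℕ → ℕ → ℚ
doubleSum p n = sum1 p (λ j → sgn j * termSum n j (suc p ∸ j))

expansion : ℕ → ℕ → ℕ → ℚ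
expansion p n k = sum1 k (λ j → sgn j * sum1 n (λ ℓ → ℕ→ℚ (suc n) * term n j (suc p ∸ j) ℓ))
                + sgn (suc k) * termSum n k (p ∸ k)

Hbar≡expansion-zero : ∀ p n → Hbar n p ≡ expansion p n 0
Hbar≡expansion-zero p n = begin
  sum1 n g                                  ≡⟨ sym (sum1-reverse n g) ⟩
  sum1 n (λ ℓ → g (suc n ∸ ℓ))              ≡⟨ sum1-cong n reflected ⟩
  sum1 n (λ ℓ → (- 1ℚ) * term n 0 p ℓ)      ≡⟨ sum1-*ˡ n (- 1ℚ) (term n 0 p) ⟩
  (- 1ℚ) * termSum n 0 p                    ≡⟨ sym (+-identityˡ _) ⟩
  0ℚ + (- 1ℚ) * termSum n 0 p               ∎
  where
  open ℚ-Solver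
  g : ℕ → ℚ
  g j = sgn (j ∸ 1) * inv (j ℕ.^ p)
  g-suc : ∀ m → g (suc m) ≡ (- 1ℚ) * (sgn (suc m) * inv (1 ℕ.* (suc m ℕ.^ p)))
  g-suc m rewrite ℕ.*-identityˡ (suc m ℕ.^ p) =
    solve 2 (λ s i → s :* i := (:- con 1ℚ) :* ((:- s) :* i)) refl (sgn m) (inv (suc m ℕ.^ p))
  reflected : ∀ ℓ → 1 ≤ ℓ → ℓ ≤ n → g (suc n ∸ ℓ) ≡ (- 1ℚ) * term n 0 p ℓ
  reflected (suc l) _ l<n with suc n ∸ suc l | ℕ.+-∸-assoc 1 l<n
  ... | .(suc (n ∸ suc l)) | refl = g-suc (n ∸ suc l)

telescope-step : ∀ n k b (S s : ℚ) →
  S + s * sum1 n (λ ℓ → ℕ→ℚ (suc n) * term n (suc k) (suc b) ℓ) + (- s) * termSum n (suc k) b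
  ≡ S + s * termSum n k (suc b)
telescope-step n k b S s = begin
  S + s * sum1 n (λ ℓ → ℕ→ℚ (suc n) * term n (suc k) (suc b) ℓ) + (- s) * Y
    ≡⟨ cong (λ z → S + s * z + (- s) * Y) (trans (sum1-cong n (term-partialFraction n k b))
                                                  (sum1-+ n (term n k (suc b)) (term n (suc k) b))) ⟩
  S + s * (X + Y) + (- s) * Y
    ≡⟨ solve 4 (λ S s X Y → S :+ s :* (X :+ Y) :+ (:- s) :* Y := S :+ s :* X) refl S s X Y ⟩
  S + s * X ∎
  where
  open ℚ-Solver
  X = termSum n k (suc b)
  Y = termSum n (suc k) b

expansion-suc : ∀ p n k → suc k ≤ p → expansion p n (suc k) ≡ expansion p n k
expansion-suc p n k k<p rewrite ℕ.+-∸-assoc 1 k<p =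
  telescope-step n k (p ∸ suc k) (sum1 k (λ j → sgn j * sum1 n (λ ℓ → ℕ→ℚ (suc n) * term n j (suc p ∸ j) ℓ)))
                 (sgn (suc k))

Hbar≡expansion : ∀ p n k → k ≤ p → Hbar n p ≡ expansion p n k
Hbar≡expansion p n zero    _   = Hbar≡expansion-zero p n
Hbar≡expansion p n (suc k) k<p = trans (Hbar≡expansion p n k (ℕ.<⇒≤ k<p)) (sym (expansion-suc p n k k<p))

termSum-top : ∀ p n → termSum n p 0 ≡ sgn n * Hbar n p
termSum-top p n = trans (sum1-cong n pointwise) (sum1-*ˡ n (sgn n) (λ j → sgn (j ∸ 1) * inv (j ℕ.^ p)))
  where
  pointwise : ∀ ℓ → 1 ≤ ℓ → ℓ ≤ n → term n p 0 ℓ ≡ sgn n * (sgn (ℓ ∸ 1) * inv (ℓ ℕ.^ p))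
  pointwise (suc l) _ l<n rewrite ℕ.*-identityʳ (suc l ℕ.^ p) | sgn-∸ n l (ℕ.<⇒≤ l<n) =
    *-assoc (sgn n) (sgn l) (inv (suc l ℕ.^ p))

Hbar-+-sgn-*-Hbar : ∀ p n → Hbar n p + sgn (p ℕ.+ n) * Hbar n p ≡ ℕ→ℚ (suc n) * doubleSum p n
Hbar-+-sgn-*-Hbar p n = begin
  H + t * H                                 ≡⟨ cong (λ z → z + t * H) (Hbar≡expansion p n p ℕ.≤-refl) ⟩
  expansion p n p + t * H                   ≡⟨ cong₂ (λ u v → u + sgn (suc p) * v + t * H) N-out top ⟩
  N * S + sgn (suc p) * (sgn n * H) + t * H ≡⟨ cong (λ z → N * S + z + t * H) sign ⟩
  N * S + (- t) * H + t * H                 ≡⟨ solve 4 (λ N S t H → N :* S :+ (:- t) :* H :+ t :* H := N :* S) refl N S t H ⟩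
  N * S                                     ∎
  where
  open ℚ-Solver
  H = Hbar n p
  N = ℕ→ℚ (suc n)
  S = doubleSum p n
  t = sgn (p ℕ.+ n)
  N-out : sum1 p (λ j → sgn j * sum1 n (λ ℓ → N * term n j (suc p ∸ j) ℓ)) ≡ N * S
  N-out = trans (sum1-cong p (λ j _ _ → trans (cong (sgn j *_) (sum1-*ˡ n N (term n j (suc p ∸ j))))
                   (solve 3 (λ s N x → s :* (N :* x) := N :* (s :* x)) refl (sgn j) N (termSum n j (suc p ∸ j)))))
                (sum1-*ˡ p N (λ j → sgn j * termSum n j (suc p ∸ j)))
  sign : sgn (suc p) * (sgn n * H) ≡ (- t) * H
  sign = trans (sym (*-assoc (sgn (suc p)) (sgn n) H)) (cong (_* H) (sym (sgn-+ (suc p) n)))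
  top : termSum n p (p ∸ p) ≡ sgn n * H
  top rewrite ℕ.n∸n≡0 p = termSum-top p n

-- The identities hold for all p and n.
proposition1 : (p n : ℕ) → 1 ≤ p → 1 ≤ n →
    ((k : ℕ) → k ≤ p →
      Hbar n p ≡
        sum1 k (λ j → sgn j * sum1 n (λ ℓ → ℕ→ℚ (suc n) * term n j (suc p ∸ j) ℓ))
        + sgn (suc k) * sum1 n (λ ℓ → term n k (p ∸ k) ℓ))
    × ((p ℕ.+ n) % 2 ≡ 0 →
      Hbar n p ≡ ((+ (suc n)) /ℚ 2) * sum1 p (λ j → sgn j * sum1 n (λ ℓ → term n j (suc p ∸ j) ℓ)))
    × ((p ℕ.+ n) % 2 ≡ 1 →
      sum1 p (λ j → sgn j * sum1 n (λ ℓ → term n j (suc p ∸ j) ℓ)) ≡ 0ℚ)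
proposition1 p n _ _ = Hbar≡expansion p n , even , odd
  where
  H = Hbar n p
  S = doubleSum p n
  h = (+ suc n) /ℚ 2
  even : (p ℕ.+ n) % 2 ≡ 0 → H ≡ h * S
  even p+n-even = x+x≡y+y⇒x≡y H (h * S) (begin
    H + H                     ≡⟨ cong (λ z → H + z) (sym (*-identityˡ H)) ⟩
    H + 1ℚ * H                ≡⟨ cong (λ z → H + z * H) (sym (trans (sgn-%2 (p ℕ.+ n)) (cong sgn p+n-even))) ⟩
    H + sgn (p ℕ.+ n) * H     ≡⟨ Hbar-+-sgn-*-Hbar p n ⟩
    ℕ→ℚ (suc n) * S           ≡⟨ cong (_* S) (sym (half-+-half (suc n))) ⟩
    (h + h) * S               ≡⟨ *-distribʳ-+ S h h ⟩
    h * S + h * S             ∎)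
  odd : (p ℕ.+ n) % 2 ≡ 1 → S ≡ 0ℚ
  odd p+n-odd = ℕ→ℚ-suc-*-zero n S (begin
    ℕ→ℚ (suc n) * S           ≡⟨ sym (Hbar-+-sgn-*-Hbar p n) ⟩
    H + sgn (p ℕ.+ n) * H     ≡⟨ cong (λ z → H + z * H) (trans (sgn-%2 (p ℕ.+ n)) (cong sgn p+n-odd)) ⟩
    H + (- 1ℚ) * H            ≡⟨ solve 1 (λ H → H :+ (:- con 1ℚ) :* H := con 0ℚ) refl H ⟩
    0ℚ                        ∎)
    where open ℚ-Solver
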